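{- In the setting described in the context, every induced subgraph of $\Gamma$ on $v\ge 16k$ vertices has more than $\frac{v^2}{32k}$ edges.
   Context: Setting: Let $0<\beta<1/5$, let $n$ be a positive integer and $k=n^{\beta}$, with $n>2^{20}k^5$. Let $G$ be a graph on $n$ vertices with at least $n^2/k$ edges. Let $G_1$ be the induced subgraph of $G$ obtained by repeatedly deleting a vertex of minimum degree until the remaining graph has minimum degree at least $\frac{n}{2k}$. Let $H$ be a bipartite subgraph of $G_1$ with the maximum possible number of edges, with vertex classes $A$ and $B$ labelled so that $|B|\le |A|$. For vertices $x_1,x_2$ of $H$, $N_H(x_1,x_2)$ denotes the set of vertices of $H$ adjacent to both, and $d_H(x_1,x_2)=|N_H(x_1,x_2)|$ is their codegree. $\Gamma$ is the auxiliary graph with vertex set $A$ in which two distinct vertices $x,y$ are adjacent if and only if $d_H(x,y)\ge \frac{n}{32k^2}$.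
   Formalization: The parameter k is rational, rather than an arbitrary real of the form $k=n^{\beta}$ with $0<\beta<1/5$. -}

module Defs where

open import Data.Nat as ℕ using (ℕ; suc)
open import Data.Bool using (Bool; true; false; _∧_; T)
open import Data.Fin using (Fin; toℕ)
open import Data.Fin.Subset using (Subset; _∈_; _∉_; _⊆_; _∩_; _∪_; _-_; ∣_∣; ⊥; ⊤)
open import Data.Vec using (tabulate; lookup)
open import Data.List using (List; map; allFin)
open import Data.Nat.ListAction using (sum)
open import Data.Integer using (+_)
open import Data.Rational using (ℚ; _/_; _*_; _≤_; _<_; _≤ᵇ_)
open import Data.Product using (_×_)
open import Data.Sum using (_⊎_)
open import Relation.Binary.PropositionalEquality using (_≡_)
open import Relation.Nullary using (¬_)

⟦_⟧ : ℕ → ℚ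
⟦ m ⟧ = (+ m) / 1

record Graph (n : ℕ) : Set where
  field
    adj    : Fin n → Fin n → Bool
    sym    : ∀ x y → adj x y ≡ adj y x
    irrefl : ∀ x → adj x x ≡ false
open Graph public

edgeCount : {n : ℕ} → (Fin n → Fin n → Bool) → ℕ
edgeCount {n} r =
  sum (map (λ i → ∣ tabulate (λ j → r i j ∧ (toℕ i ℕ.<ᵇ toℕ j)) ∣) (allFin n))

degIn : {n : ℕ} → Graph n → Subset n → Fin n → ℕ
degIn G S v = ∣ S ∩ tabulate (adj G v) ∣

-- G[S] has minimum degree at least n/(2k)  (i.e. n ≤ 2k·deg, k > 0)
MinDegOK : {n : ℕ} → Graph n → ℚ → Subset n → Set
MinDegOK {n} G k S = ∀ v → v ∈ S → ⟦ n ⟧ ≤ ⟦ 2 ⟧ * k * ⟦ degIn G S v ⟧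

-- The deletion process: starting from S, repeatedly delete a vertex of
-- minimum degree (in the current induced subgraph) as long as the minimum
-- degree is below n/(2k); `Reaches G k S T` means the process started at S
-- can end (stop for the first time) at T.  Ties are resolved arbitrarily.
data Reaches {n : ℕ} (G : Graph n) (k : ℚ) : Subset n → Subset n → Set where
  done : ∀ {S} → MinDegOK G k S → Reaches G k S S
  step : ∀ {S T} (v : Fin n) → ¬ MinDegOK G k S → v ∈ S →
         (∀ u → u ∈ S → degIn G S v ℕ.≤ degIn G S u) →
         Reaches G k (S - v) T → Reaches G k S T

record BipSub {n : ℕ} (G : Graph n) (S : Subset n) : Set where
  field
    W A B    : Subset n
    hadj     : Fin n → Fin n → Bool
    W⊆S      : W ⊆ S
    A∪B      : A ∪ B ≡ W
    A∩B      : A ∩ B ≡ ⊥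
    hsym     : ∀ x y → hadj x y ≡ hadj y x
    hsub     : ∀ x y → T (hadj x y) → T (adj G x y)
    hcross   : ∀ x y → T (hadj x y) → (x ∈ A × y ∈ B) ⊎ (x ∈ B × y ∈ A)
open BipSub public

IsMaxBip : {n : ℕ} {G : Graph n} {S : Subset n} → BipSub G S → Set
IsMaxBip {G = G} {S} H = ∀ (H' : BipSub G S) → edgeCount (hadj H') ℕ.≤ edgeCount (hadj H)

codeg : {n : ℕ} {G : Graph n} {S : Subset n} → BipSub G S → Fin n → Fin n → ℕ
codeg H x y = ∣ tabulate (λ z → hadj H x z ∧ hadj H y z) ∣

-- adjacency of Γ (on vertex set A): x ≠ y, both in A, d_H(x,y) ≥ n/(32k²)
-- written as n ≤ 32 k² d_H(x,y).  (Irreflexivity is enforced in edgeCount,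
-- which only counts pairs with toℕ x < toℕ y.)
Γadj : {n : ℕ} {G : Graph n} {S : Subset n} → ℚ → BipSub G S → Fin n → Fin n → Bool
Γadj {n} k H x y = ⟦ n ⟧ ≤ᵇ ⟦ 32 ⟧ * k * k * ⟦ codeg H x y ⟧

edgesΓIn : {n : ℕ} {G : Graph n} {S : Subset n} → ℚ → BipSub G S → Subset n → ℕ
edgesΓIn k H U = edgeCount (λ x y → Γadj k H x y ∧ lookup U x ∧ lookup U y)

module Submission where

-- By maximality of H, every x ∈ A keeps at least half of its degree
-- in G₁ (moving x to B, or giving x all its neighbours in B and outside H,
-- does not increase the number of edges), so deg_H(x) ≥ n/(4k).  Let D be
-- the least H-degree on U and let every x ∈ U choose D of its H-neighbours,
-- all lying in B.  Cauchy–Schwarz over B gives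
-- (Dv)² ≤ |B| · Σ_{x,y ∈ U} |N(x) ∩ N(y)|, and |B| ≤ n/2.  A pair contributes
-- at most D when it is an edge of Γ or x = y, and less than n/(32k²)
-- otherwise, so the sum is at most D(2e + v) + v²n/(32k²).  Since
-- D ≥ n/(4k) and v ≥ 16k, comparing the two bounds gives v² < 32ke.

open import Defs hiding (sym)
open import Data.Nat as ℕ using (ℕ; zero; suc; z≤n; s≤s; s≤s⁻¹; _+_; _*_; _⊓_; _≤_; _<_)
open import Data.Nat.Properties
open import Data.Nat.Tactic.RingSolver using (solve-∀)
open import Algebra.Properties.Semiring.Sum +-*-semiring
  using (sum; sum-syntax; sum-cong-≗; sum-replicate-zero; ∑-distrib-+; ∑-comm; *-distribˡ-sum; *-distribʳ-sum)
open import Data.Fin using (Fin; zero; suc; toℕ)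
import Data.Fin.Properties as Fin
open import Data.Product using (Σ; _×_; _,_; proj₁; proj₂)
open import Data.Sum using (_⊎_; inj₁; inj₂)
open import Relation.Binary.PropositionalEquality
open import Relation.Nullary using (¬_; Dec; does; yes; no; ofʸ; ofⁿ)
open import Relation.Nullary.Decidable using (dec-true; dec-false)
open import Relation.Binary using (tri<; tri≈; tri>)
open import Data.Bool using (Bool; true; false; _∧_; _∨_; not; T; if_then_else_)
open import Data.Bool.Properties using (∧-comm; ∧-identityʳ; ∧-zeroʳ; ∨-identityʳ; ∨-zeroʳ; T-≡)
open import Function.Bundles using (Equivalence)
open import Data.Vec using (Vec; lookup; tabulate)
import Data.Vec.Properties as Vec
import Data.Vec.Functional as Vector
open import Data.List using (map; allFin)
import Data.List as List
open import Data.Nat.ListAction using () renaming (sum to sumList)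
open import Data.Fin.Subset using (Subset; _∈_; _∩_; _∪_; _⊆_; ⊤) renaming (∣_∣ to card; ⊥ to ∅)
open import Data.Fin.Subset.Properties using (∣p∣≤n)
open import Data.Empty using (⊥-elim)
import Data.Integer as ℤ
import Data.Integer.Properties as ℤ
open import Data.Rational as ℚ using (ℚ; mkℚ)
open import Data.Nat.Coprimality using (Coprime)
import Data.Rational.Properties as ℚ
open import Data.Rational.Unnormalised using (mkℚᵘ; _≃_; *≤*; *<*)
import Data.Rational.Unnormalised.Properties as ℚᵘ

-- Finite sums of natural numbers indexed by Fin n

sum-mono : ∀ {n} {f g : Fin n → ℕ} → (∀ i → f i ≤ g i) → sum f ≤ sum g
sum-mono {zero}  f≤g = z≤n
sum-mono {suc n} f≤g = +-mono-≤ (f≤g zero) (sum-mono (λ i → f≤g (suc i)))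

sum-const-1 : ∀ n → ∑[ i < n ] 1 ≡ n
sum-const-1 zero    = refl
sum-const-1 (suc n) = cong suc (sum-const-1 n)

sum-*-sum : ∀ {m n} (f : Fin m → ℕ) (g : Fin n → ℕ) →
            sum f * sum g ≡ ∑[ i < m ] ∑[ j < n ] (f i * g j)
sum-*-sum f g = trans (*-distribʳ-sum (sum g) f) (sum-cong-≗ (λ i → *-distribˡ-sum (f i) g))

sum-update : ∀ {n} (P Q : Fin n → ℕ) (x : Fin n) → (∀ i → i ≢ x → P i ≡ Q i) →
             sum P + Q x ≡ sum Q + P x
sum-update {suc n} P Q zero agree =
  trans (cong (λ s → P zero + s + Q zero) (sum-cong-≗ (λ i → agree (suc i) λ ())))
        (swap-ends (P zero) (sum (λ i → Q (suc i))) (Q zero))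
  where
  swap-ends : ∀ a s b → a + s + b ≡ b + s + a
  swap-ends = solve-∀
sum-update {suc n} P Q (suc x) agree
  rewrite agree zero (λ ())
  = trans (+-assoc (Q zero) _ (Q (suc x)))
      (trans (cong (Q zero +_) (sum-update (λ i → P (suc i)) (λ i → Q (suc i)) x
                                  (λ i i≢x → agree (suc i) (λ eq → i≢x (Fin.suc-injective eq)))))
             (sym (+-assoc (Q zero) _ (P (suc x)))))

-- The Cauchy–Schwarz inequality for natural numbers:
-- (Σ bᵢaᵢ)² ≤ (Σ bᵢ²)(Σ aᵢ²).  It follows by summing 2xy ≤ x² + y²
-- over x = bᵢaⱼ, y = bⱼaᵢ.
2xy≤x²+y²-ordered : ∀ x y → x ≤ y → 2 * (x * y) ≤ x * x + y * y
2xy≤x²+y²-ordered x y x≤y with m≤n⇒∃[o]m+o≡n x≤y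
... | t , refl = subst (2 * (x * (x + t)) ≤_) (sym (expand x t)) (m≤m+n _ _)
  where
  expand : ∀ x t → x * x + (x + t) * (x + t) ≡ 2 * (x * (x + t)) + t * t
  expand = solve-∀

2xy≤x²+y² : ∀ x y → 2 * (x * y) ≤ x * x + y * y
2xy≤x²+y² x y with ≤-total x y
... | inj₁ x≤y = 2xy≤x²+y²-ordered x y x≤y
... | inj₂ y≤x = subst₂ _≤_ (cong (2 *_) (*-comm y x)) (+-comm (y * y) (x * x)) (2xy≤x²+y²-ordered y x y≤x)

cauchy-schwarz : ∀ {n} (b a : Fin n → ℕ) →
  (∑[ i < n ] (b i * a i)) * (∑[ i < n ] (b i * a i)) ≤ (∑[ i < n ] (b i * b i)) * (∑[ i < n ] (a i * a i))
cauchy-schwarz {n} b a = *-cancelˡ-≤ 2 (begin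
  2 * (∑ba * ∑ba)                               ≡⟨ cong (2 *_) (sum-*-sum ba ba) ⟩
  2 * (∑[ i < n ] ∑[ j < n ] (ba i * ba j))     ≡⟨ *-distribˡ-sum 2 (λ i → ∑[ j < n ] (ba i * ba j)) ⟩
  ∑[ i < n ] (2 * ∑[ j < n ] (ba i * ba j))     ≡⟨ sum-cong-≗ (λ i → *-distribˡ-sum 2 (λ j → ba i * ba j)) ⟩
  ∑[ i < n ] ∑[ j < n ] (2 * (ba i * ba j))     ≤⟨ sum-mono (λ i → sum-mono (λ j → pointwise i j)) ⟩
  ∑[ i < n ] ∑[ j < n ] (X i j + X j i)         ≡⟨ sum-cong-≗ (λ i → ∑-distrib-+ (X i) (λ j → X j i)) ⟩
  ∑[ i < n ] (∑[ j < n ] X i j + ∑[ j < n ] X j i)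
                                                ≡⟨ ∑-distrib-+ (λ i → ∑[ j < n ] X i j) (λ i → ∑[ j < n ] X j i) ⟩
  R + ∑[ i < n ] ∑[ j < n ] X j i               ≡⟨ cong (R +_) (∑-comm (λ i j → X j i)) ⟩
  R + R                                         ≡⟨ cong (R +_) (sym (+-identityʳ R)) ⟩
  2 * R                                         ≡⟨ cong (2 *_) (sym (sum-*-sum (λ i → b i * b i) (λ i → a i * a i))) ⟩
  2 * ((∑[ i < n ] (b i * b i)) * (∑[ i < n ] (a i * a i))) ∎)
  where
  open ≤-Reasoning
  ba : Fin n → ℕ
  ba i = b i * a i
  ∑ba : ℕ
  ∑ba = sum ba
  X : Fin n → Fin n → ℕ
  X i j = (b i * b i) * (a j * a j)
  R : ℕ
  R = ∑[ i < n ] ∑[ j < n ] X i j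
  pointwise : ∀ i j → 2 * (ba i * ba j) ≤ X i j + X j i
  pointwise i j = subst₂ _≤_ (cong (2 *_) (regroup (b i) (a i) (b j) (a j))) (squares (b i) (a i) (b j) (a j))
                    (2xy≤x²+y² (b i * a j) (b j * a i))
    where
    regroup : ∀ bi ai bj aj → (bi * aj) * (bj * ai) ≡ (bi * ai) * (bj * aj)
    regroup = solve-∀
    squares : ∀ bi ai bj aj → (bi * aj) * (bi * aj) + (bj * ai) * (bj * ai) ≡ (bi * bi) * (aj * aj) + (bj * bj) * (ai * ai)
    squares = solve-∀

least : ∀ {m} → ℕ → (Fin m → ℕ) → ℕ
least {zero}  top f = top
least {suc m} top f = f zero ⊓ least top (λ i → f (suc i))

least-≤ : ∀ {m} top (f : Fin m → ℕ) i → least top f ≤ f i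
least-≤ top f zero    = m⊓n≤m _ _
least-≤ top f (suc i) = ≤-trans (m⊓n≤n _ _) (least-≤ top (λ i → f (suc i)) i)

least-attained : ∀ {m} top (f : Fin m → ℕ) → least top f ≡ top ⊎ Σ (Fin m) (λ i → least top f ≡ f i)
least-attained {zero}  top f = inj₁ refl
least-attained {suc m} top f with ⊓-sel (f zero) (least top (λ i → f (suc i)))
... | inj₁ e = inj₂ (zero , e)
... | inj₂ e with least-attained top (λ i → f (suc i))
...   | inj₁ e′       = inj₁ (trans e e′)
...   | inj₂ (i , e′) = inj₂ (suc i , trans e e′)

-- Indicators and cardinalities

χ : Bool → ℕ
χ true  = 1
χ false = 0

χ≤1 : ∀ b → χ b ≤ 1
χ≤1 true  = s≤s z≤n
χ≤1 false = z≤n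

χ*χ≤χˡ : ∀ a b → χ a * χ b ≤ χ a
χ*χ≤χˡ true  b = ≤-trans (≤-reflexive (+-identityʳ (χ b))) (χ≤1 b)
χ*χ≤χˡ false b = z≤n

χ*χ≤χʳ : ∀ a b → χ a * χ b ≤ χ b
χ*χ≤χʳ true  b = ≤-reflexive (+-identityʳ (χ b))
χ*χ≤χʳ false b = z≤n

χ-∧ : ∀ a b → χ (a ∧ b) ≡ χ a * χ b
χ-∧ true  true  = refl
χ-∧ true  false = refl
χ-∧ false b     = refl

χ² : ∀ b → χ b * χ b ≡ χ b
χ² true  = refl
χ² false = refl

∧-true-l : ∀ {a b} → (a ∧ b) ≡ true → a ≡ true
∧-true-l {true} _ = refl

∧-true-r : ∀ {a b} → (a ∧ b) ≡ true → b ≡ true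
∧-true-r {true} e = e

card-tabulate : ∀ {n} (f : Fin n → Bool) → card (tabulate f) ≡ ∑[ i < n ] χ (f i)
card-tabulate {zero}  f = refl
card-tabulate {suc n} f with f zero
... | true  = cong suc (card-tabulate (λ i → f (suc i)))
... | false = card-tabulate (λ i → f (suc i))

card≡∑χ : ∀ {n} (p : Subset n) → card p ≡ ∑[ i < n ] χ (lookup p i)
card≡∑χ p = trans (cong card (sym (Vec.tabulate∘lookup p))) (card-tabulate (lookup p))

subset-of-size : ∀ {m} (a : Fin m → Bool) t → t ≤ ∑[ j < m ] χ (a j) →
                 Σ (Fin m → Bool) λ b → (∀ j → b j ≡ true → a j ≡ true) × ∑[ j < m ] χ (b j) ≡ t
subset-of-size {zero}  a zero    _ = (λ _ → false) , (λ _ ()) , refl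
subset-of-size {suc m} a zero    _ = (λ _ → false) , (λ _ ()) , sum-replicate-zero (suc m)
subset-of-size {suc m} a (suc t) t<∑ with a zero in a₀
... | true  with subset-of-size (λ j → a (suc j)) t (s≤s⁻¹ t<∑)
...   | b , b⊆a , |b| = (true Vector.∷ b) , ⊆a , cong suc |b|
  where
  ⊆a : ∀ j → (true Vector.∷ b) j ≡ true → a j ≡ true
  ⊆a zero    _ = a₀
  ⊆a (suc j) e = b⊆a j e
subset-of-size {suc m} a (suc t) t<∑
    | false with subset-of-size (λ j → a (suc j)) (suc t) t<∑
...   | b , b⊆a , |b| = (false Vector.∷ b) , ⊆a , |b|
  where
  ⊆a : ∀ j → (false Vector.∷ b) j ≡ true → a j ≡ true
  ⊆a zero    ()
  ⊆a (suc j) e = b⊆a j e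

-- Edge counts and the handshake lemma.  `edgeCount r` counts the pairs
-- i < j with r i j; for a symmetric r the full double sum of r counts
-- each such pair twice, plus the diagonal.

_<ᶠ_ : ∀ {n} → Fin n → Fin n → Bool
i <ᶠ j = toℕ i ℕ.<ᵇ toℕ j

_≟ᶠ_ : ∀ {n} → Fin n → Fin n → Bool
i ≟ᶠ j = does (i Fin.≟ j)

edgeCount≡∑∑ : ∀ {n} (r : Fin n → Fin n → Bool) →
               edgeCount r ≡ ∑[ i < n ] ∑[ j < n ] χ (r i j ∧ i <ᶠ j)
edgeCount≡∑∑ {n} r = trans (sumList-allFin (λ i → card (tabulate (λ j → r i j ∧ i <ᶠ j))))
                            (sum-cong-≗ (λ i → card-tabulate (λ j → r i j ∧ i <ᶠ j)))
  where
  sumList-allFin : (g : Fin n → ℕ) → sumList (map g (allFin n)) ≡ sum g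
  sumList-allFin g = go (λ i → i)
    where
    go : ∀ {m} (h : Fin m → Fin n) → sumList (map g (List.tabulate h)) ≡ ∑[ i < m ] g (h i)
    go {zero}  h = refl
    go {suc m} h = cong (g (h zero) +_) (go (λ i → h (suc i)))

<ᵇ-true : ∀ {m n} → m < n → (m ℕ.<ᵇ n) ≡ true
<ᵇ-true {m} {n} m<n with m ℕ.<ᵇ n | <ᵇ-reflects-< m n
... | true  | _         = refl
... | false | ofⁿ m≮n = ⊥-elim (m≮n m<n)

<ᵇ-false : ∀ {m n} → n ≤ m → (m ℕ.<ᵇ n) ≡ false
<ᵇ-false {m} {n} n≤m with m ℕ.<ᵇ n | <ᵇ-reflects-< m n
... | false | _        = refl
... | true  | ofʸ m<n = ⊥-elim (<⇒≱ m<n n≤m)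

trichotomy-χ : ∀ {n} (i j : Fin n) → χ (i <ᶠ j) + χ (j <ᶠ i) + χ (i ≟ᶠ j) ≡ 1
trichotomy-χ i j with <-cmp (toℕ i) (toℕ j)
... | tri< i<j _ _
  rewrite <ᵇ-true i<j | <ᵇ-false (<⇒≤ i<j) | dec-false (i Fin.≟ j) (λ i≡j → <-irrefl (cong toℕ i≡j) i<j) = refl
... | tri> _ _ j<i
  rewrite <ᵇ-true j<i | <ᵇ-false (<⇒≤ j<i) | dec-false (i Fin.≟ j) (λ i≡j → <-irrefl (cong toℕ (sym i≡j)) j<i) = refl
... | tri≈ _ i≡j _ with Fin.toℕ-injective i≡j
... | refl rewrite <ᵇ-false (≤-refl {toℕ i}) | dec-true (i Fin.≟ i) refl = refl

split-by-order : ∀ {n} (r : Fin n → Fin n → Bool) → (∀ i j → r i j ≡ r j i) → ∀ i j →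
                 χ (r i j) ≡ χ (r i j ∧ i <ᶠ j) + χ (r j i ∧ j <ᶠ i) + χ (r i j ∧ i ≟ᶠ j)
split-by-order r r-sym i j = begin
  χ (r i j)                                                                   ≡⟨ sym (*-identityʳ _) ⟩
  χ (r i j) * 1                                                               ≡⟨ cong (χ (r i j) *_) (sym (trichotomy-χ i j)) ⟩
  χ (r i j) * (χ (i <ᶠ j) + χ (j <ᶠ i) + χ (i ≟ᶠ j))                          ≡⟨ distrib (χ (r i j)) _ _ _ ⟩
  χ (r i j) * χ (i <ᶠ j) + χ (r i j) * χ (j <ᶠ i) + χ (r i j) * χ (i ≟ᶠ j)   ≡⟨ sym (cong₂ _+_ (cong₂ _+_
                                                                                   (χ-∧ (r i j) (i <ᶠ j))
                                                                                   (trans (cong (λ b → χ (b ∧ j <ᶠ i)) (r-sym j i)) (χ-∧ (r i j) (j <ᶠ i))))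
                                                                                   (χ-∧ (r i j) (i ≟ᶠ j))) ⟩
  χ (r i j ∧ i <ᶠ j) + χ (r j i ∧ j <ᶠ i) + χ (r i j ∧ i ≟ᶠ j)                ∎
  where
  open ≡-Reasoning
  distrib : ∀ a x y z → a * (x + y + z) ≡ a * x + a * y + a * z
  distrib = solve-∀

sum-diagonal : ∀ {n} (f : Fin n → Bool) (i : Fin n) → ∑[ j < n ] χ (f j ∧ i ≟ᶠ j) ≡ χ (f i)
sum-diagonal {n} f i = begin
  ∑[ j < n ] χ (f j ∧ i ≟ᶠ j)         ≡⟨ sym (+-identityʳ _) ⟩
  ∑[ j < n ] χ (f j ∧ i ≟ᶠ j) + 0     ≡⟨ sum-update (λ j → χ (f j ∧ i ≟ᶠ j)) (λ _ → 0) i off-diagonal ⟩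
  ∑[ j < n ] 0 + χ (f i ∧ i ≟ᶠ i)     ≡⟨ cong₂ _+_ (sum-replicate-zero n) (cong (λ b → χ (f i ∧ b)) (dec-true (i Fin.≟ i) refl)) ⟩
  χ (f i ∧ true)                      ≡⟨ cong χ (∧-identityʳ (f i)) ⟩
  χ (f i)                             ∎
  where
  open ≡-Reasoning
  off-diagonal : ∀ j → j ≢ i → χ (f j ∧ i ≟ᶠ j) ≡ 0
  off-diagonal j j≢i rewrite dec-false (i Fin.≟ j) (λ i≡j → j≢i (sym i≡j)) | ∧-zeroʳ (f j) = refl

handshake : ∀ {n} (r : Fin n → Fin n → Bool) → (∀ i j → r i j ≡ r j i) →
            ∑[ i < n ] ∑[ j < n ] χ (r i j) ≡ 2 * edgeCount r + ∑[ i < n ] χ (r i i)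
handshake {n} r r-sym = begin
  ∑[ i < n ] ∑[ j < n ] χ (r i j)                                       ≡⟨ sum-cong-≗ (λ i → sum-cong-≗ (split-by-order r r-sym i)) ⟩
  ∑[ i < n ] ∑[ j < n ] (below i j + below j i + diag i j)              ≡⟨ sum-cong-≗ (λ i → ∑-distrib-+ (λ j → below i j + below j i) (diag i)) ⟩
  ∑[ i < n ] (∑[ j < n ] (below i j + below j i) + ∑[ j < n ] diag i j) ≡⟨ ∑-distrib-+ (λ i → ∑[ j < n ] (below i j + below j i)) (λ i → ∑[ j < n ] diag i j) ⟩
  ∑[ i < n ] ∑[ j < n ] (below i j + below j i) + ∑[ i < n ] ∑[ j < n ] diag i j
                                                                        ≡⟨ cong₂ _+_ twice-E (sum-cong-≗ (λ i → sum-diagonal (r i) i)) ⟩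
  E + E + ∑[ i < n ] χ (r i i)                                          ≡⟨ cong (λ m → E + m + D) (sym (+-identityʳ E)) ⟩
  2 * E + ∑[ i < n ] χ (r i i)                                          ≡⟨ cong (λ m → 2 * m + D) (sym (edgeCount≡∑∑ r)) ⟩
  2 * edgeCount r + ∑[ i < n ] χ (r i i)                                ∎
  where
  open ≡-Reasoning
  below diag : Fin n → Fin n → ℕ
  below i j = χ (r i j ∧ i <ᶠ j)
  diag i j = χ (r i j ∧ i ≟ᶠ j)
  E : ℕ
  E = ∑[ i < n ] ∑[ j < n ] below i j
  D : ℕ
  D = ∑[ i < n ] χ (r i i)
  twice-E : ∑[ i < n ] ∑[ j < n ] (below i j + below j i) ≡ E + E
  twice-E = trans (sum-cong-≗ (λ i → ∑-distrib-+ (below i) (λ j → below j i)))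
                  (trans (∑-distrib-+ (λ i → ∑[ j < n ] below i j) (λ i → ∑[ j < n ] below j i))
                         (cong (E +_) (∑-comm (λ i j → below j i))))

-- Rewiring a graph at one vertex

deg : ∀ {n} → (Fin n → Fin n → Bool) → Fin n → ℕ
deg {n} h x = ∑[ j < n ] χ (h x j)

Symmetric Loopless : ∀ {n} → (Fin n → Fin n → Bool) → Set
Symmetric h = ∀ i j → h i j ≡ h j i
Loopless  h = ∀ i → h i i ≡ false

degree-sum : ∀ {n} (h : Fin n → Fin n → Bool) → Symmetric h → Loopless h →
             ∑[ i < n ] deg h i ≡ 2 * edgeCount h
degree-sum {n} h h-sym h-loopless = begin
  ∑[ i < n ] deg h i                            ≡⟨ handshake h h-sym ⟩
  2 * edgeCount h + ∑[ i < n ] χ (h i i)        ≡⟨ cong (λ m → 2 * edgeCount h + m)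
                                                     (trans (sum-cong-≗ (λ i → cong χ (h-loopless i))) (sum-replicate-zero n)) ⟩
  2 * edgeCount h + 0                           ≡⟨ +-identityʳ _ ⟩
  2 * edgeCount h                               ∎
  where open ≡-Reasoning

rewire-edgeCount : ∀ {n} (h h′ : Fin n → Fin n → Bool) (x : Fin n) →
  Symmetric h → Symmetric h′ → Loopless h → Loopless h′ →
  (∀ i j → i ≢ x → j ≢ x → h′ i j ≡ h i j) →
  edgeCount h′ + deg h x ≡ edgeCount h + deg h′ x
rewire-edgeCount {n} h h′ x h-sym h′-sym h-loopless h′-loopless agree = *-cancelˡ-≡ _ _ 2 (begin
  2 * (E′ + d)                  ≡⟨ double (edgeCount h′) d ⟩
  2 * E′ + d + d                ≡⟨ cong (λ m → m + d + d) (sym (degree-sum h′ h′-sym h′-loopless)) ⟩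
  ∑[ i < n ] deg h′ i + d + d   ≡⟨ cong₂ _+_ (sym ∑P) (sym (trans (cong (λ b → d + χ b) (h′-loopless x)) (+-identityʳ d))) ⟩
  sum P + Q x                   ≡⟨ sum-update P Q x P≡Q-off-x ⟩
  sum Q + P x                   ≡⟨ cong₂ _+_ ∑Q (trans (cong (λ b → d′ + χ b) (h-loopless x)) (+-identityʳ d′)) ⟩
  ∑[ i < n ] deg h i + d′ + d′  ≡⟨ cong (λ m → m + d′ + d′) (degree-sum h h-sym h-loopless) ⟩
  2 * E + d′ + d′               ≡⟨ sym (double (edgeCount h) d′) ⟩
  2 * (E + d′)                  ∎)
  where
  open ≡-Reasoning
  E E′ d d′ : ℕ
  E  = edgeCount h
  E′ = edgeCount h′
  d  = deg h x
  d′ = deg h′ x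
  double : ∀ a b → 2 * (a + b) ≡ 2 * a + b + b
  double = solve-∀
  -- row i of each relation, corrected by the entry in column x of the other
  P Q : Fin n → ℕ
  P i = deg h′ i + χ (h i x)
  Q i = deg h i + χ (h′ i x)
  P≡Q-off-x : ∀ i → i ≢ x → P i ≡ Q i
  P≡Q-off-x i i≢x = sum-update (λ j → χ (h′ i j)) (λ j → χ (h i j)) x (λ j j≢x → cong χ (agree i j i≢x j≢x))
  column : ∀ (g : Fin n → Fin n → Bool) → Symmetric g → ∑[ i < n ] χ (g i x) ≡ deg g x
  column g g-sym = sum-cong-≗ (λ i → cong χ (g-sym i x))
  ∑P : sum P ≡ ∑[ i < n ] deg h′ i + d
  ∑P = trans (∑-distrib-+ (deg h′) (λ i → χ (h i x))) (cong (_ +_) (column h h-sym))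
  ∑Q : sum Q ≡ ∑[ i < n ] deg h i + d′
  ∑Q = trans (∑-distrib-+ (deg h) (λ i → χ (h′ i x))) (cong (_ +_) (column h′ h′-sym))

-- Bipartite subgraphs, read through characteristic functions

vec-ext : ∀ {A : Set} {n} {u v : Vec A n} → (∀ i → lookup u i ≡ lookup v i) → u ≡ v
vec-ext {u = u} {v} same = trans (sym (Vec.tabulate∘lookup u)) (trans (Vec.tabulate-cong same) (Vec.tabulate∘lookup v))

∈⇒true : ∀ {n} {p : Subset n} {i} → i ∈ p → lookup p i ≡ true
∈⇒true = Vec.[]=⇒lookup

true⇒∈ : ∀ {n} {p : Subset n} {i} → lookup p i ≡ true → i ∈ p
true⇒∈ {p = p} {i} = Vec.lookup⇒[]= i p

edge⇒≢ : ∀ {n} (G : Graph n) {x j} → adj G x j ≡ true → j ≢ x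
edge⇒≢ G {x} e refl with trans (sym e) (irrefl G x)
... | ()

module _ {n : ℕ} {G : Graph n} {S : Subset n} (H : BipSub G S) where

  isA isB isS : Fin n → Bool
  isA = lookup (A H)
  isB = lookup (B H)
  isS = lookup S

  Crosses : (Fin n → Bool) → (Fin n → Bool) → Fin n → Fin n → Set
  Crosses a b i j = (a i ≡ true × b j ≡ true) ⊎ (b i ≡ true × a j ≡ true)

  classes-disjoint : ∀ j → (isA j ∧ isB j) ≡ false
  classes-disjoint j = trans (sym (Vec.lookup-zipWith _∧_ j (A H) (B H)))
                             (trans (cong (λ p → lookup p j) (A∩B H)) (Vec.lookup-replicate j false))

  classes⊆S : ∀ j → (isA j ∨ isB j) ≡ true → isS j ≡ true
  classes⊆S j j∈A∪B = ∈⇒true (W⊆S H (true⇒∈ (trans (cong (λ p → lookup p j) (sym (A∪B H)))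
                                              (trans (Vec.lookup-zipWith _∨_ j (A H) (B H)) j∈A∪B))))

  H-edge⇒G-edge : ∀ i j → hadj H i j ≡ true → adj G i j ≡ true
  H-edge⇒G-edge i j e = Equivalence.to T-≡ (hsub H i j (Equivalence.from T-≡ e))

  H-loopless : Loopless (hadj H)
  H-loopless i with hadj H i i in e
  ... | false = refl
  ... | true  = ⊥-elim (edge⇒≢ G (H-edge⇒G-edge i i e) refl)

  H-crosses : ∀ i j → hadj H i j ≡ true → Crosses isA isB i j
  H-crosses i j e with hcross H i j (Equivalence.from T-≡ e)
  ... | inj₁ (i∈A , j∈B) = inj₁ (∈⇒true i∈A , ∈⇒true j∈B)
  ... | inj₂ (i∈B , j∈A) = inj₂ (∈⇒true i∈B , ∈⇒true j∈A)

  record Rewiring (x : Fin n) : Set where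
    field
      N′ A′ B′     : Fin n → Bool
      disjoint     : ∀ j → (A′ j ∧ B′ j) ≡ false
      within-S     : ∀ j → (A′ j ∨ B′ j) ≡ true → isS j ≡ true
      N′⊆G         : ∀ j → N′ j ≡ true → adj G x j ≡ true
      N′-crosses   : ∀ j → N′ j ≡ true → Crosses A′ B′ x j
      old-crosses  : ∀ i j → i ≢ x → j ≢ x → hadj H i j ≡ true → Crosses A′ B′ i j

  module Rewired {x : Fin n} (R : Rewiring x) where
    open Rewiring R

    h′ : Fin n → Fin n → Bool
    h′ i j = if i ≟ᶠ x then N′ j else if j ≟ᶠ x then N′ i else hadj H i j

    h′-row-x : ∀ j → h′ x j ≡ N′ j
    h′-row-x j rewrite dec-true (x Fin.≟ x) refl = refl

    h′-column-x : ∀ i → i ≢ x → h′ i x ≡ N′ i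
    h′-column-x i i≢x rewrite dec-false (i Fin.≟ x) i≢x | dec-true (x Fin.≟ x) refl = refl

    h′-away : ∀ i j → i ≢ x → j ≢ x → h′ i j ≡ hadj H i j
    h′-away i j i≢x j≢x rewrite dec-false (i Fin.≟ x) i≢x | dec-false (j Fin.≟ x) j≢x = refl

    N′-x : N′ x ≡ false
    N′-x with N′ x in e
    ... | false = refl
    ... | true  = ⊥-elim (edge⇒≢ G (N′⊆G x e) refl)

    h′-sym : Symmetric h′
    h′-sym i j = by-cases (i Fin.≟ x) (j Fin.≟ x)
      where
      by-cases : Dec (i ≡ x) → Dec (j ≡ x) → h′ i j ≡ h′ j i
      by-cases (yes refl) (yes refl) = refl
      by-cases (yes refl) (no j≢x)   = trans (h′-row-x j) (sym (h′-column-x j j≢x))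
      by-cases (no i≢x)   (yes refl) = trans (h′-column-x i i≢x) (sym (h′-row-x i))
      by-cases (no i≢x)   (no j≢x)   = trans (h′-away i j i≢x j≢x) (trans (hsym H i j) (sym (h′-away j i j≢x i≢x)))

    h′-loopless : Loopless h′
    h′-loopless i = by-cases (i Fin.≟ x)
      where
      by-cases : Dec (i ≡ x) → h′ i i ≡ false
      by-cases (yes refl) = trans (h′-row-x x) N′-x
      by-cases (no i≢x)   = trans (h′-away i i i≢x i≢x) (H-loopless i)

    h′⊆G : ∀ i j → h′ i j ≡ true → adj G i j ≡ true
    h′⊆G i j e = by-cases (i Fin.≟ x) (j Fin.≟ x)
      where
      by-cases : Dec (i ≡ x) → Dec (j ≡ x) → adj G i j ≡ true
      by-cases (yes refl) _          = N′⊆G j (trans (sym (h′-row-x j)) e)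
      by-cases (no i≢x)   (yes refl) = trans (Graph.sym G i x) (N′⊆G i (trans (sym (h′-column-x i i≢x)) e))
      by-cases (no i≢x)   (no j≢x)   = H-edge⇒G-edge i j (trans (sym (h′-away i j i≢x j≢x)) e)

    h′-crosses : ∀ i j → h′ i j ≡ true → Crosses A′ B′ i j
    h′-crosses i j e = by-cases (i Fin.≟ x) (j Fin.≟ x)
      where
      flip : ∀ {a b} → Crosses a b j i → Crosses a b i j
      flip (inj₁ (p , q)) = inj₂ (q , p)
      flip (inj₂ (p , q)) = inj₁ (q , p)
      by-cases : Dec (i ≡ x) → Dec (j ≡ x) → Crosses A′ B′ i j
      by-cases (yes refl) _          = N′-crosses j (trans (sym (h′-row-x j)) e)
      by-cases (no i≢x)   (yes refl) = flip (N′-crosses i (trans (sym (h′-column-x i i≢x)) e))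
      by-cases (no i≢x)   (no j≢x)   = old-crosses i j i≢x j≢x (trans (sym (h′-away i j i≢x j≢x)) e)

    private
      ∈-tabulate : ∀ (f : Fin n → Bool) {j} → f j ≡ true → j ∈ tabulate f
      ∈-tabulate f {j} e = true⇒∈ (trans (Vec.lookup∘tabulate f j) e)

      lookup-∪ : ∀ j → lookup (tabulate A′ ∪ tabulate B′) j ≡ (A′ j ∨ B′ j)
      lookup-∪ j = trans (Vec.lookup-zipWith _∨_ j (tabulate A′) (tabulate B′))
                         (cong₂ _∨_ (Vec.lookup∘tabulate A′ j) (Vec.lookup∘tabulate B′ j))

      lookup-∩ : ∀ j → lookup (tabulate A′ ∩ tabulate B′) j ≡ (A′ j ∧ B′ j)
      lookup-∩ j = trans (Vec.lookup-zipWith _∧_ j (tabulate A′) (tabulate B′))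
                         (cong₂ _∧_ (Vec.lookup∘tabulate A′ j) (Vec.lookup∘tabulate B′ j))

    H′ : BipSub G S
    H′ = record
      { W      = tabulate A′ ∪ tabulate B′
      ; A      = tabulate A′
      ; B      = tabulate B′
      ; hadj   = h′
      ; W⊆S    = λ {j} j∈W → true⇒∈ (within-S j (trans (sym (lookup-∪ j)) (∈⇒true j∈W)))
      ; A∪B    = refl
      ; A∩B    = vec-ext (λ j → trans (lookup-∩ j) (trans (disjoint j) (sym (Vec.lookup-replicate j false))))
      ; hsym   = h′-sym
      ; hsub   = λ i j t → Equivalence.from T-≡ (h′⊆G i j (Equivalence.to T-≡ t))
      ; hcross = λ i j t → as-membership (h′-crosses i j (Equivalence.to T-≡ t))
      }
      where
      as-membership : ∀ {i j} → Crosses A′ B′ i j →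
                      (i ∈ tabulate A′ × j ∈ tabulate B′) ⊎ (i ∈ tabulate B′ × j ∈ tabulate A′)
      as-membership (inj₁ (p , q)) = inj₁ (∈-tabulate A′ p , ∈-tabulate B′ q)
      as-membership (inj₂ (p , q)) = inj₂ (∈-tabulate B′ p , ∈-tabulate A′ q)

  -- In a maximum bipartite subgraph no rewiring at x can give x more
  -- neighbours than it has: otherwise the rewired subgraph has more edges.
  rewiring-bound : IsMaxBip H → ∀ {x} (R : Rewiring x) → ∑[ j < n ] χ (Rewiring.N′ R j) ≤ deg (hadj H) x
  rewiring-bound maximal {x} R = +-cancelˡ-≤ (edgeCount (hadj H)) _ _ (begin
    edgeCount (hadj H) + ∑[ j < n ] χ (N′ j)
                                   ≡⟨ cong (edgeCount (hadj H) +_) (sum-cong-≗ (λ j → cong χ (sym (h′-row-x j)))) ⟩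
    edgeCount (hadj H) + deg h′ x  ≡⟨ sym (rewire-edgeCount (hadj H) h′ x (hsym H) h′-sym H-loopless h′-loopless h′-away) ⟩
    edgeCount h′ + deg (hadj H) x  ≤⟨ +-monoˡ-≤ _ (maximal H′) ⟩
    edgeCount (hadj H) + deg (hadj H) x ∎)
    where
    open Rewiring R
    open Rewired R
    open ≤-Reasoning

  -- x ∈ A may move to B, taking as new neighbours all its G-neighbours in A.
  move-to-B : ∀ {x} → isA x ≡ true → Rewiring x
  move-to-B {x} x∈A = record
    { N′ = λ j → adj G x j ∧ isA j
    ; A′ = λ j → isA j ∧ not (j ≟ᶠ x)
    ; B′ = λ j → isB j ∨ j ≟ᶠ x
    ; disjoint = λ j → still-disjoint (isA j) (isB j) (j ≟ᶠ x) (classes-disjoint j)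
    ; within-S = λ j e → in-S j (j Fin.≟ x) e
    ; N′⊆G = λ j → ∧-true-l
    ; N′-crosses = λ j e → inj₂ (x∈B′ , j∈A′ j e)
    ; old-crosses = old
    }
    where
    still-disjoint : ∀ a b e → (a ∧ b) ≡ false → ((a ∧ not e) ∧ (b ∨ e)) ≡ false
    still-disjoint true  true  _     ()
    still-disjoint true  false true  _ = refl
    still-disjoint true  false false _ = refl
    still-disjoint false _     _     _ = refl
    in-S : ∀ j → Dec (j ≡ x) → ((isA j ∧ not (j ≟ᶠ x)) ∨ (isB j ∨ j ≟ᶠ x)) ≡ true → isS j ≡ true
    in-S j (yes refl) _ = classes⊆S x (cong (_∨ isB x) x∈A)
    in-S j (no j≢x)   e rewrite dec-false (j Fin.≟ x) j≢x | ∧-identityʳ (isA j) | ∨-identityʳ (isB j) = classes⊆S j e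
    x∈B′ : (isB x ∨ x ≟ᶠ x) ≡ true
    x∈B′ rewrite dec-true (x Fin.≟ x) refl = ∨-zeroʳ (isB x)
    j∈A′ : ∀ j → (adj G x j ∧ isA j) ≡ true → (isA j ∧ not (j ≟ᶠ x)) ≡ true
    j∈A′ j e rewrite dec-false (j Fin.≟ x) (edge⇒≢ G (∧-true-l e)) = trans (∧-identityʳ (isA j)) (∧-true-r e)
    old : ∀ i j → i ≢ x → j ≢ x → hadj H i j ≡ true →
          Crosses (λ j → isA j ∧ not (j ≟ᶠ x)) (λ j → isB j ∨ j ≟ᶠ x) i j
    old i j i≢x j≢x e
      rewrite dec-false (i Fin.≟ x) i≢x | dec-false (j Fin.≟ x) j≢x
            | ∧-identityʳ (isA i) | ∧-identityʳ (isA j) | ∨-identityʳ (isB i) | ∨-identityʳ (isB j)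
      = H-crosses i j e

  isOut : Fin n → Bool
  isOut j = isS j ∧ not (isA j ∨ isB j)

  -- x ∈ A may stay in A and take as new neighbours all its G-neighbours in
  -- B and outside W (these join B).
  extend-in-A : ∀ {x} → isA x ≡ true → Rewiring x
  extend-in-A {x} x∈A = record
    { N′ = λ j → adj G x j ∧ (isB j ∨ isOut j)
    ; A′ = isA
    ; B′ = λ j → isB j ∨ isOut j
    ; disjoint = λ j → still-disjoint (isA j) (isB j) (isS j) (classes-disjoint j)
    ; within-S = in-S
    ; N′⊆G = λ j → ∧-true-l
    ; N′-crosses = λ j e → inj₁ (x∈A , ∧-true-r e)
    ; old-crosses = λ i j _ _ e → widen (H-crosses i j e)
    }
    where
    still-disjoint : ∀ a b s → (a ∧ b) ≡ false → (a ∧ (b ∨ (s ∧ not (a ∨ b)))) ≡ false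
    still-disjoint true  true  _     ()
    still-disjoint true  false true  _ = refl
    still-disjoint true  false false _ = refl
    still-disjoint false _     _     _ = refl
    in-S : ∀ j → (isA j ∨ (isB j ∨ isOut j)) ≡ true → isS j ≡ true
    in-S j e with isA j in a | isB j in b
    ... | true  | _     = classes⊆S j (cong (_∨ isB j) a)
    ... | false | true  = classes⊆S j (trans (cong₂ _∨_ a b) refl)
    ... | false | false = ∧-true-l e
    widen : ∀ {i j} → Crosses isA isB i j → Crosses isA (λ j → isB j ∨ isOut j) i j
    widen {i} {j} (inj₁ (p , q)) = inj₁ (p , cong (_∨ isOut j) q)
    widen {i} {j} (inj₂ (p , q)) = inj₂ (cong (_∨ isOut i) p , q)

  -- Every vertex of A keeps at least half of its degree in G[S]:
  -- its neighbours in A, in B and outside W are counted by the two rewirings.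
  max-cut-degree : IsMaxBip H → ∀ {x} → isA x ≡ true → degIn G S x ≤ 2 * deg (hadj H) x
  max-cut-degree maximal {x} x∈A = begin
    degIn G S x                                                   ≡⟨ degIn≡∑ ⟩
    ∑[ j < n ] χ (isS j ∧ adj G x j)                              ≤⟨ sum-mono (λ j → split (isS j) (isA j) (isB j) (adj G x j)) ⟩
    ∑[ j < n ] (χ (Rewiring.N′ toB j) + χ (Rewiring.N′ inA j))    ≡⟨ ∑-distrib-+ (λ j → χ (Rewiring.N′ toB j)) (λ j → χ (Rewiring.N′ inA j)) ⟩
    ∑[ j < n ] χ (Rewiring.N′ toB j) + ∑[ j < n ] χ (Rewiring.N′ inA j)
                                                                  ≤⟨ +-mono-≤ (rewiring-bound maximal toB) (rewiring-bound maximal inA) ⟩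
    deg (hadj H) x + deg (hadj H) x                               ≡⟨ cong (deg (hadj H) x +_) (sym (+-identityʳ _)) ⟩
    2 * deg (hadj H) x                                            ∎
    where
    open ≤-Reasoning
    toB inA : Rewiring x
    toB = move-to-B x∈A
    inA = extend-in-A x∈A
    degIn≡∑ : degIn G S x ≡ ∑[ j < n ] χ (isS j ∧ adj G x j)
    degIn≡∑ = trans (card≡∑χ (S ∩ tabulate (adj G x)))
                    (sum-cong-≗ (λ j → cong χ (trans (Vec.lookup-zipWith _∧_ j S (tabulate (adj G x)))
                                                     (cong (isS j ∧_) (Vec.lookup∘tabulate (adj G x) j)))))
    split : ∀ s a b e → χ (s ∧ e) ≤ χ (e ∧ a) + χ (e ∧ (b ∨ (s ∧ not (a ∨ b))))
    split false _     _     _     = z≤n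
    split true  _     _     false = z≤n
    split true  true  _     true  = s≤s z≤n
    split true  false true  true  = s≤s z≤n
    split true  false false true  = s≤s z≤n

classes-size : ∀ {n} {G : Graph n} {S : Subset n} (H : BipSub G S) → card (A H) + card (B H) ≤ n
classes-size {n} H = begin
  card (A H) + card (B H)                               ≡⟨ cong₂ _+_ (card≡∑χ (A H)) (card≡∑χ (B H)) ⟩
  ∑[ i < n ] χ (isA H i) + ∑[ i < n ] χ (isB H i)       ≡⟨ sym (∑-distrib-+ (λ i → χ (isA H i)) (λ i → χ (isB H i))) ⟩
  ∑[ i < n ] (χ (isA H i) + χ (isB H i))                ≤⟨ sum-mono (λ i → at-most-one (isA H i) (isB H i) (classes-disjoint H i)) ⟩
  ∑[ i < n ] 1                                          ≡⟨ sum-const-1 n ⟩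
  n                                                     ∎
  where
  open ≤-Reasoning
  at-most-one : ∀ a b → (a ∧ b) ≡ false → χ a + χ b ≤ 1
  at-most-one true  true  ()
  at-most-one true  false _ = s≤s z≤n
  at-most-one false true  _ = s≤s z≤n
  at-most-one false false _ = z≤n

codeg-sym : ∀ {n} {G : Graph n} {S : Subset n} (H : BipSub G S) → ∀ x y → codeg H x y ≡ codeg H y x
codeg-sym H x y = cong card (Vec.tabulate-cong (λ z → ∧-comm (hadj H x z) (hadj H y z)))

Γ-sym : ∀ {n} {G : Graph n} {S : Subset n} (k : ℚ) (H : BipSub G S) → Symmetric (Γadj k H)
Γ-sym {n} k H x y = cong (λ c → ⟦ n ⟧ ℚ.≤ᵇ ⟦ 32 ⟧ ℚ.* k ℚ.* k ℚ.* ⟦ c ⟧) (codeg-sym H x y)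

-- Double counting with Cauchy–Schwarz: if the sets N x all lie inside a set
-- β, then (Σₓ |N x|)² ≤ |β| · Σₓ Σᵧ |N x ∩ N y|.
intersections-bound : ∀ {n} (N : Fin n → Fin n → Bool) (β : Fin n → Bool) →
  (∀ x z → N x z ≡ true → β z ≡ true) →
  let total = ∑[ x < n ] ∑[ z < n ] χ (N x z) in
  total * total ≤ (∑[ z < n ] χ (β z)) * ∑[ x < n ] ∑[ y < n ] ∑[ z < n ] (χ (N x z) * χ (N y z))
intersections-bound {n} N β N⊆β = subst₂ _≤_ (cong₂ _*_ ∑βa≡total ∑βa≡total) (cong₂ _*_ ∑β²≡∑β ∑a²≡∑∑∩)
                                    (cauchy-schwarz (λ z → χ (β z)) a)
  where
  -- the number of sets containing z, which vanishes outside β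
  a : Fin n → ℕ
  a z = ∑[ x < n ] χ (N x z)
  covered-only-in-β : ∀ z → χ (β z) * a z ≡ a z
  covered-only-in-β z with β z in βz
  ... | true  = +-identityʳ (a z)
  ... | false = sym (trans (sum-cong-≗ (λ x → cong χ (not-in x))) (sum-replicate-zero n))
    where
    not-in : ∀ x → N x z ≡ false
    not-in x with N x z in e
    ... | false = refl
    ... | true with trans (sym (N⊆β x z e)) βz
    ...   | ()
  ∑βa≡total : ∑[ z < n ] (χ (β z) * a z) ≡ ∑[ x < n ] ∑[ z < n ] χ (N x z)
  ∑βa≡total = trans (sum-cong-≗ covered-only-in-β) (∑-comm (λ z x → χ (N x z)))
  ∑β²≡∑β : ∑[ z < n ] (χ (β z) * χ (β z)) ≡ ∑[ z < n ] χ (β z)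
  ∑β²≡∑β = sum-cong-≗ (λ z → χ² (β z))
  ∑a²≡∑∑∩ : ∑[ z < n ] (a z * a z) ≡ ∑[ x < n ] ∑[ y < n ] ∑[ z < n ] (χ (N x z) * χ (N y z))
  ∑a²≡∑∑∩ = trans (sum-cong-≗ (λ z → sum-*-sum (λ x → χ (N x z)) (λ y → χ (N y z))))
              (trans (∑-comm (λ z x → ∑[ y < n ] (χ (N x z) * χ (N y z))))
                     (sum-cong-≗ (λ x → ∑-comm (λ z y → χ (N x z) * χ (N y z)))))

pair-sum-bound : ∀ {n} (c : Fin n → Fin n → ℕ) (r : Fin n → Fin n → Bool) (u : Fin n → Bool) (M D L : ℕ) →
  Symmetric r → (∀ i → χ (r i i) ≤ χ (u i)) →
  (∀ x y → M * c x y ≤ M * D * χ (r x y) + L * (χ (u x) * χ (u y))) →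
  let |U| = ∑[ i < n ] χ (u i) in
  M * ∑[ x < n ] ∑[ y < n ] c x y ≤ M * D * (2 * edgeCount r + |U|) + L * (|U| * |U|)
pair-sum-bound {n} c r u M D L r-sym loops⊆U pairwise = begin
  M * ∑[ x < n ] ∑[ y < n ] c x y                                       ≡⟨ *-distribˡ-sum M (λ x → ∑[ y < n ] c x y) ⟩
  ∑[ x < n ] (M * ∑[ y < n ] c x y)                                     ≡⟨ sum-cong-≗ (λ x → *-distribˡ-sum M (c x)) ⟩
  ∑[ x < n ] ∑[ y < n ] (M * c x y)                                     ≤⟨ sum-mono (λ x → sum-mono (pairwise x)) ⟩
  ∑[ x < n ] ∑[ y < n ] (M * D * χ (r x y) + L * (χ (u x) * χ (u y)))  ≡⟨ split-sum ⟩
  M * D * ∑[ x < n ] ∑[ y < n ] χ (r x y) + L * ∑[ x < n ] ∑[ y < n ] (χ (u x) * χ (u y))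
                                                                        ≤⟨ +-mono-≤ (*-monoʳ-≤ (M * D) r-sum) (≤-reflexive (cong (L *_) u-sum)) ⟩
  M * D * (2 * edgeCount r + |U|) + L * (|U| * |U|)                     ∎
  where
  open ≤-Reasoning
  |U| : ℕ
  |U| = ∑[ i < n ] χ (u i)
  scale : ∀ m (f : Fin n → Fin n → ℕ) → ∑[ x < n ] ∑[ y < n ] (m * f x y) ≡ m * ∑[ x < n ] ∑[ y < n ] f x y
  scale m f = trans (sum-cong-≗ (λ x → sym (*-distribˡ-sum m (f x)))) (sym (*-distribˡ-sum m (λ x → ∑[ y < n ] f x y)))
  split-sum : ∑[ x < n ] ∑[ y < n ] (M * D * χ (r x y) + L * (χ (u x) * χ (u y))) ≡
              M * D * ∑[ x < n ] ∑[ y < n ] χ (r x y) + L * ∑[ x < n ] ∑[ y < n ] (χ (u x) * χ (u y))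
  split-sum = trans (sum-cong-≗ (λ x → ∑-distrib-+ (λ y → M * D * χ (r x y)) (λ y → L * (χ (u x) * χ (u y)))))
                (trans (∑-distrib-+ (λ x → ∑[ y < n ] (M * D * χ (r x y))) (λ x → ∑[ y < n ] (L * (χ (u x) * χ (u y)))))
                       (cong₂ _+_ (scale (M * D) (λ x y → χ (r x y))) (scale L (λ x y → χ (u x) * χ (u y)))))
  r-sum : ∑[ x < n ] ∑[ y < n ] χ (r x y) ≤ 2 * edgeCount r + |U|
  r-sum = ≤-trans (≤-reflexive (handshake r r-sym)) (+-monoʳ-≤ (2 * edgeCount r) (sum-mono loops⊆U))
  u-sum : ∑[ x < n ] ∑[ y < n ] (χ (u x) * χ (u y)) ≡ |U| * |U|
  u-sum = sym (sum-*-sum (λ x → χ (u x)) (λ y → χ (u y)))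

-- Here D is the common size of the
-- chosen neighbourhoods, v = |U|, b = |B|, T the sum of their pairwise
-- intersections, e the number of close pairs in U, and k = p / q.

three-Dv²≤2n[2e+v] : ∀ p q D v b n T e → 1 ≤ p → 1 ≤ D →
  (D * v) * (D * v) ≤ b * T → 2 * b ≤ n →
  32 * p * p * T ≤ 32 * p * p * D * (2 * e + v) + n * q * q * (v * v) →
  n * q ≤ 4 * p * D → 3 * D * (v * v) ≤ 2 * n * (2 * e + v)
three-Dv²≤2n[2e+v] p q D v b n T e 1≤p 1≤D Dv²≤bT 2b≤n T-bound nq≤4pD =
  *-cancelˡ-≤ (16 * p * p * D) {{16p²D≢0}} (+-cancelʳ-≤ _ _ _ (begin
    16 * p * p * D * (3 * D * (v * v)) + 16 * p * p * D * D * (v * v)  ≡⟨ e₁ p D v ⟩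
    (32 * p * p * 2) * ((D * v) * (D * v))                              ≤⟨ *-monoʳ-≤ (32 * p * p * 2) Dv²≤bT ⟩
    (32 * p * p * 2) * (b * T)                                          ≡⟨ e₂ p b T ⟩
    (2 * b) * (32 * p * p * T)                                          ≤⟨ *-mono-≤ 2b≤n T-bound ⟩
    n * (32 * p * p * D * (2 * e + v) + n * q * q * (v * v))            ≡⟨ e₃ n p D e v q ⟩
    16 * p * p * D * (2 * n * (2 * e + v)) + (n * q) * (n * q) * (v * v)
                                                                        ≤⟨ +-monoʳ-≤ (16 * p * p * D * (2 * n * (2 * e + v))) (*-monoˡ-≤ (v * v) (*-mono-≤ nq≤4pD nq≤4pD)) ⟩
    16 * p * p * D * (2 * n * (2 * e + v)) + (4 * p * D) * (4 * p * D) * (v * v)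
                                                                        ≡⟨ cong (16 * p * p * D * (2 * n * (2 * e + v)) +_) (e₄ p D v) ⟩
    16 * p * p * D * (2 * n * (2 * e + v)) + 16 * p * p * D * D * (v * v) ∎))
  where
  open ≤-Reasoning
  16p²D≢0 : ℕ.NonZero (16 * p * p * D)
  16p²D≢0 = ℕ.>-nonZero (*-mono-≤ (*-mono-≤ (*-mono-≤ (s≤s (z≤n {15})) 1≤p) 1≤p) 1≤D)
  e₁ : ∀ p D v → 16 * p * p * D * (3 * D * (v * v)) + 16 * p * p * D * D * (v * v) ≡ (32 * p * p * 2) * ((D * v) * (D * v))
  e₁ = solve-∀
  e₂ : ∀ p b T → (32 * p * p * 2) * (b * T) ≡ (2 * b) * (32 * p * p * T)
  e₂ = solve-∀
  e₃ : ∀ n p D e v q → n * (32 * p * p * D * (2 * e + v) + n * q * q * (v * v)) ≡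
                      16 * p * p * D * (2 * n * (2 * e + v)) + (n * q) * (n * q) * (v * v)
  e₃ = solve-∀
  e₄ : ∀ p D v → (4 * p * D) * (4 * p * D) * (v * v) ≡ 16 * p * p * D * D * (v * v)
  e₄ = solve-∀

v²q<32pe : ∀ p q D v n e → 1 ≤ D → 1 ≤ q → 1 ≤ v →
  3 * D * (v * v) ≤ 2 * n * (2 * e + v) → n * q ≤ 4 * p * D → 16 * p ≤ v * q →
  v * v * q < 32 * p * e
v²q<32pe p q D v n e 1≤D 1≤q 1≤v 3Dv²≤ nq≤4pD 16p≤vq = begin-strict
  v * v * q                    <⟨ m<m*n (v * v * q) 5 {{ℕ.>-nonZero (*-mono-≤ (*-mono-≤ 1≤v 1≤v) 1≤q)}} (s≤s (s≤s z≤n)) ⟩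
  v * v * q * 5                ≤⟨ +-cancelʳ-≤ _ _ _ (begin
    v * v * q * 5 + v * v * q    ≡⟨ e₁ v q ⟩
    2 * (3 * (v * v * q))        ≤⟨ *-monoʳ-≤ 2 3v²q≤ ⟩
    2 * (16 * p * e + 8 * p * v) ≡⟨ e₂ p e v ⟩
    32 * p * e + (16 * p) * v    ≤⟨ +-monoʳ-≤ (32 * p * e) (*-monoˡ-≤ v 16p≤vq) ⟩
    32 * p * e + v * q * v       ≡⟨ cong (32 * p * e +_) (e₃ v q) ⟩
    32 * p * e + v * v * q       ∎) ⟩
  32 * p * e                   ∎
  where
  open ≤-Reasoning
  e₁ : ∀ v q → v * v * q * 5 + v * v * q ≡ 2 * (3 * (v * v * q))
  e₁ = solve-∀
  e₂ : ∀ p e v → 2 * (16 * p * e + 8 * p * v) ≡ 32 * p * e + (16 * p) * v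
  e₂ = solve-∀
  e₃ : ∀ v q → v * q * v ≡ v * v * q
  e₃ = solve-∀
  e₄ : ∀ D v q → D * (3 * (v * v * q)) ≡ 3 * D * (v * v) * q
  e₄ = solve-∀
  e₅ : ∀ n e v q → 2 * n * (2 * e + v) * q ≡ 2 * (n * q) * (2 * e + v)
  e₅ = solve-∀
  e₆ : ∀ p D e v → 2 * (4 * p * D) * (2 * e + v) ≡ D * (16 * p * e + 8 * p * v)
  e₆ = solve-∀
  3v²q≤ : 3 * (v * v * q) ≤ 16 * p * e + 8 * p * v
  3v²q≤ = *-cancelˡ-≤ D {{ℕ.>-nonZero 1≤D}} (begin
    D * (3 * (v * v * q))        ≡⟨ e₄ D v q ⟩
    3 * D * (v * v) * q          ≤⟨ *-monoˡ-≤ q 3Dv²≤ ⟩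
    2 * n * (2 * e + v) * q      ≡⟨ e₅ n e v q ⟩
    2 * (n * q) * (2 * e + v)    ≤⟨ *-monoˡ-≤ (2 * e + v) (*-monoʳ-≤ 2 nq≤4pD) ⟩
    2 * (4 * p * D) * (2 * e + v) ≡⟨ e₆ p D e v ⟩
    D * (16 * p * e + 8 * p * v) ∎)

-- The counting argument, with k = p / q and all quantities natural numbers.
-- `close` is the adjacency of Γ: non-close pairs have codegree < n / (32k²).
module CloseCodegrees
  {n : ℕ} {G : Graph n} {S : Subset n} (H : BipSub G S) (maximal : IsMaxBip H) (B≤A : card (B H) ≤ card (A H))
  (p q : ℕ) (q<p : q < p) (1≤q : 1 ≤ q)
  (min-degree : ∀ x → x ∈ S → n * q ≤ 2 * p * degIn G S x)
  (close : Fin n → Fin n → Bool) (close-sym : Symmetric close)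
  (far⇒small : ∀ x y → close x y ≡ false → 32 * p * p * codeg H x y < n * (q * q))
  (U : Subset n) (U⊆A : U ⊆ A H) (16p≤vq : 16 * p ≤ card U * q)
  where

  v : ℕ
  v = card U

  u : Fin n → Bool
  u = lookup U

  closeIn : Fin n → Fin n → Bool
  closeIn x y = close x y ∧ u x ∧ u y

  e : ℕ
  e = edgeCount closeIn

  degH : Fin n → ℕ
  degH = deg (hadj H)

  U⊆A′ : ∀ x → u x ≡ true → isA H x ≡ true
  U⊆A′ x x∈U = ∈⇒true (U⊆A (true⇒∈ x∈U))

  U-degree : ∀ x → u x ≡ true → n * q ≤ 4 * p * degH x
  U-degree x x∈U = begin
    n * q                    ≤⟨ min-degree x (true⇒∈ (classes⊆S H x (cong (_∨ isB H x) (U⊆A′ x x∈U)))) ⟩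
    2 * p * degIn G S x      ≤⟨ *-monoʳ-≤ (2 * p) (max-cut-degree H maximal (U⊆A′ x x∈U)) ⟩
    2 * p * (2 * degH x)     ≡⟨ regroup p (degH x) ⟩
    4 * p * degH x           ∎
    where
    open ≤-Reasoning
    regroup : ∀ p d → 2 * p * (2 * d) ≡ 4 * p * d
    regroup = solve-∀

  D : ℕ
  D = least n (λ x → if u x then degH x else n)

  D≤degH : ∀ x → u x ≡ true → D ≤ degH x
  D≤degH x x∈U = subst (λ b → D ≤ (if b then degH x else n)) x∈U (least-≤ n _ x)

  nq≤4pn : n * q ≤ 4 * p * n
  nq≤4pn = ≤-trans (*-monoʳ-≤ n (<⇒≤ q<p)) (≤-trans (≤-reflexive (*-comm n p)) (*-monoˡ-≤ n (m≤n*m p 4)))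

  nq≤4pD : n * q ≤ 4 * p * D
  nq≤4pD with least-attained n (λ x → if u x then degH x else n)
  ... | inj₁ D≡n      = subst (λ m → n * q ≤ 4 * p * m) (sym D≡n) nq≤4pn
  ... | inj₂ (x , D≡) = subst (λ m → n * q ≤ 4 * p * m) (sym D≡) (at x (u x) refl)
    where
    at : ∀ x b → u x ≡ b → n * q ≤ 4 * p * (if b then degH x else n)
    at x true  x∈U = U-degree x x∈U
    at x false _   = nq≤4pn

  private
    enough : ∀ x → D * χ (u x) ≤ ∑[ z < n ] χ (u x ∧ hadj H x z)
    enough x with u x in x∈U
    ... | true  = ≤-trans (≤-reflexive (*-identityʳ D)) (D≤degH x x∈U)
    ... | false = subst (_≤ ∑[ z < n ] 0) (sym (*-zeroʳ D)) z≤n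

    choice : ∀ x → Σ (Fin n → Bool) λ b → (∀ z → b z ≡ true → (u x ∧ hadj H x z) ≡ true) ×
                                          ∑[ z < n ] χ (b z) ≡ D * χ (u x)
    choice x = subset-of-size (λ z → u x ∧ hadj H x z) (D * χ (u x)) (enough x)

  N : Fin n → Fin n → Bool
  N x = proj₁ (choice x)

  N-size : ∀ x → ∑[ z < n ] χ (N x z) ≡ D * χ (u x)
  N-size x = proj₂ (proj₂ (choice x))

  N⊆U : ∀ x z → N x z ≡ true → u x ≡ true
  N⊆U x z z∈N = ∧-true-l (proj₁ (proj₂ (choice x)) z z∈N)

  N⊆H : ∀ x z → N x z ≡ true → hadj H x z ≡ true
  N⊆H x z z∈N = ∧-true-r (proj₁ (proj₂ (choice x)) z z∈N)

  N⊆B : ∀ x z → N x z ≡ true → isB H z ≡ true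
  N⊆B x z z∈N with H-crosses H x z (N⊆H x z z∈N)
  ... | inj₁ (_ , z∈B) = z∈B
  ... | inj₂ (x∈B , _) with trans (sym (cong₂ _∧_ (U⊆A′ x (N⊆U x z z∈N)) x∈B)) (classes-disjoint H x)
  ...   | ()

  common : Fin n → Fin n → ℕ
  common x y = ∑[ z < n ] (χ (N x z) * χ (N y z))

  commonTotal : ℕ
  commonTotal = ∑[ x < n ] ∑[ y < n ] common x y

  Dv²≤|B|·commonTotal : (D * v) * (D * v) ≤ card (B H) * commonTotal
  Dv²≤|B|·commonTotal = subst₂ _≤_ (cong₂ _*_ total≡Dv total≡Dv) (cong (_* commonTotal) (sym (card≡∑χ (B H))))
                          (intersections-bound N (isB H) N⊆B)
    where
    total≡Dv : ∑[ x < n ] ∑[ z < n ] χ (N x z) ≡ D * v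
    total≡Dv = trans (sum-cong-≗ N-size) (trans (sym (*-distribˡ-sum D (λ x → χ (u x)))) (cong (D *_) (sym (card≡∑χ U))))

  common≤|Nx| : ∀ x y → common x y ≤ D * χ (u x)
  common≤|Nx| x y = ≤-trans (sum-mono (λ z → χ*χ≤χˡ (N x z) (N y z))) (≤-reflexive (N-size x))

  common≤|Ny| : ∀ x y → common x y ≤ D * χ (u y)
  common≤|Ny| x y = ≤-trans (sum-mono (λ z → χ*χ≤χʳ (N x z) (N y z))) (≤-reflexive (N-size y))

  common≤codeg : ∀ x y → common x y ≤ codeg H x y
  common≤codeg x y = ≤-trans (sum-mono (λ z → both (N x z) (N y z) (N⊆H x z) (N⊆H y z)))
                             (≤-reflexive (sym (card-tabulate (λ z → hadj H x z ∧ hadj H y z))))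
    where
    both : ∀ {c d} a b → (a ≡ true → c ≡ true) → (b ≡ true → d ≡ true) → χ a * χ b ≤ χ (c ∧ d)
    both true  true  a⇒c b⇒d rewrite a⇒c refl | b⇒d refl = s≤s z≤n
    both true  false _   _   = z≤n
    both false _     _   _   = z≤n

  vanishes : ∀ {x y m} → common x y ≤ D * 0 → 32 * p * p * common x y ≤ m
  vanishes c≤0 = ≤-trans (*-monoʳ-≤ (32 * p * p) (≤-trans c≤0 (≤-reflexive (*-zeroʳ D))))
                         (≤-trans (≤-reflexive (*-zeroʳ (32 * p * p))) z≤n)

  -- a close pair of U has at most D common chosen neighbours, a far pair
  -- fewer than n / (32k²), and a pair meeting the complement of U none
  pairwise : ∀ x y → 32 * p * p * common x y ≤ 32 * p * p * D * χ (closeIn x y) + n * q * q * (χ (u x) * χ (u y))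
  pairwise x y = by-cases (u x) (u y) (close x y) refl refl refl
    where
    regroup : ∀ n q → n * (q * q) ≡ n * q * q * (1 * 1)
    regroup = solve-∀
    by-cases : ∀ a b c → u x ≡ a → u y ≡ b → close x y ≡ c →
               32 * p * p * common x y ≤ 32 * p * p * D * χ (c ∧ a ∧ b) + n * q * q * (χ a * χ b)
    by-cases false _     _     x∉U _   _   = vanishes (subst (λ b → common x y ≤ D * χ b) x∉U (common≤|Nx| x y))
    by-cases true  false _     _   y∉U _   = vanishes (subst (λ b → common x y ≤ D * χ b) y∉U (common≤|Ny| x y))
    by-cases true  true  true  x∈U _   _   =
      ≤-trans (*-monoʳ-≤ (32 * p * p) (subst (λ b → common x y ≤ D * χ b) x∈U (common≤|Nx| x y)))
              (≤-trans (≤-reflexive (sym (*-assoc (32 * p * p) D 1))) (m≤m+n _ _))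
    by-cases true  true  false _   _   x≁y =
      ≤-trans (*-monoʳ-≤ (32 * p * p) (common≤codeg x y))
              (≤-trans (<⇒≤ (far⇒small x y x≁y)) (≤-trans (≤-reflexive (regroup n q)) (m≤n+m _ _)))

  commonTotal-bound : 32 * p * p * commonTotal ≤ 32 * p * p * D * (2 * e + v) + n * q * q * (v * v)
  commonTotal-bound = subst (λ m → 32 * p * p * commonTotal ≤ 32 * p * p * D * (2 * e + m) + n * q * q * (m * m))
                            (sym (card≡∑χ U))
                            (pair-sum-bound common closeIn u (32 * p * p) D (n * q * q) closeIn-sym loops⊆U pairwise)
    where
    closeIn-sym : Symmetric closeIn
    closeIn-sym x y = cong₂ _∧_ (close-sym x y) (∧-comm (u x) (u y))
    loops⊆U : ∀ i → χ (closeIn i i) ≤ χ (u i)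
    loops⊆U i with close i i | u i
    ... | true  | true  = ≤-refl
    ... | true  | false = z≤n
    ... | false | _     = z≤n

  2|B|≤n : 2 * card (B H) ≤ n
  2|B|≤n = begin
    2 * card (B H)          ≡⟨ cong (card (B H) +_) (+-identityʳ _) ⟩
    card (B H) + card (B H) ≤⟨ +-monoˡ-≤ (card (B H)) B≤A ⟩
    card (A H) + card (B H) ≤⟨ classes-size H ⟩
    n                       ∎
    where open ≤-Reasoning

  positive-factor : ∀ {c} m b → 1 ≤ c → c ≤ m * b → 1 ≤ m
  positive-factor zero    b 1≤c c≤0 = ⊥-elim (<⇒≱ 1≤c c≤0)
  positive-factor (suc m) b _   _   = s≤s z≤n

  1≤p : 1 ≤ p
  1≤p = ≤-trans (s≤s z≤n) q<p

  1≤v : 1 ≤ v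
  1≤v = positive-factor v q (≤-trans 1≤p (m≤n*m p 16)) 16p≤vq

  1≤D : 1 ≤ D
  1≤D = positive-factor D (4 * p) (*-mono-≤ (≤-trans 1≤v (∣p∣≤n U)) 1≤q)
                        (≤-trans nq≤4pD (≤-reflexive (*-comm (4 * p) D)))

  many-close-pairs : v * v * q < 32 * p * e
  many-close-pairs = v²q<32pe p q D v n e 1≤D 1≤q 1≤v
    (three-Dv²≤2n[2e+v] p q D v (card (B H)) n commonTotal e 1≤p 1≤D Dv²≤|B|·commonTotal 2|B|≤n commonTotal-bound nq≤4pD)
    nq≤4pD 16p≤vq

-- Comparing rationals by cross-multiplication

-- `Fraction x a b` says that the rational x equals a / (1 + b).
record Fraction (x : ℚ) (a b : ℕ) : Set where
  constructor fraction
  field equal : ℚ.toℚᵘ x ≃ mkℚᵘ (ℤ.+ a) b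

fraction-⟦⟧ : ∀ c → Fraction ⟦ c ⟧ c 0
fraction-⟦⟧ c = fraction (ℚ.toℚᵘ-fromℚᵘ (mkℚᵘ (ℤ.+ c) 0))

-- (a / (1+b)) (c / (1+d)) = ac / ((1+b)(1+d)), and (1+b)(1+d) = 1 + (d + b(1+d))
fraction-* : ∀ {x y a b c d} → Fraction x a b → Fraction y c d → Fraction (x ℚ.* y) (a * c) (d + b * suc d)
fraction-* {x} {y} {a} {b} {c} {d} (fraction x≃) (fraction y≃) = fraction
  (ℚᵘ.≃-trans (ℚ.toℚᵘ-homo-* x y)
    (ℚᵘ.≃-trans (ℚᵘ.*-cong x≃ y≃) (ℚᵘ.≃-reflexive (cong (λ z → mkℚᵘ z (d + b * suc d)) (sym (ℤ.pos-* a c))))))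

fraction-≤ : ∀ {x y a b c d} → Fraction x a b → Fraction y c d → x ℚ.≤ y → a * suc d ≤ c * suc b
fraction-≤ {x} {y} {a} {b} {c} {d} (fraction x≃) (fraction y≃) x≤y
  with ℚᵘ.≤-respˡ-≃ x≃ (ℚᵘ.≤-respʳ-≃ y≃ (ℚ.toℚᵘ-mono-≤ x≤y))
... | *≤* h rewrite sym (ℤ.pos-* a (suc d)) | sym (ℤ.pos-* c (suc b)) = ℤ.drop‿+≤+ h

fraction-< : ∀ {x y a b c d} → Fraction x a b → Fraction y c d → x ℚ.< y → a * suc d < c * suc b
fraction-< {x} {y} {a} {b} {c} {d} (fraction x≃) (fraction y≃) x<y
  with ℚᵘ.<-respˡ-≃ x≃ (ℚᵘ.<-respʳ-≃ y≃ (ℚ.toℚᵘ-mono-< x<y))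
... | *<* h rewrite sym (ℤ.pos-* a (suc d)) | sym (ℤ.pos-* c (suc b)) = ℤ.drop‿+<+ h

fraction-<⁻ : ∀ {x y a b c d} → Fraction x a b → Fraction y c d → a * suc d < c * suc b → x ℚ.< y
fraction-<⁻ {x} {y} {a} {b} {c} {d} (fraction x≃) (fraction y≃) h =
  ℚ.toℚᵘ-cancel-< (ℚᵘ.<-respˡ-≃ (ℚᵘ.≃-sym x≃) (ℚᵘ.<-respʳ-≃ (ℚᵘ.≃-sym y≃) (*<* cross)))
  where
  cross : ℤ.+ a ℤ.* ℤ.+ suc d ℤ.< ℤ.+ c ℤ.* ℤ.+ suc b
  cross rewrite sym (ℤ.pos-* a (suc d)) | sym (ℤ.pos-* c (suc b)) = ℤ.+<+ h

-- the denominators produced by `fraction-*` for the products we need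
denominator-1·q : ∀ m → ℕ.suc (0 + (m + 0 * ℕ.suc m) * ℕ.suc 0) ≡ ℕ.suc m
denominator-1·q = solve-∀

denominator-1·q·q : ∀ m → ℕ.suc (0 + (m + (m + 0 * ℕ.suc m) * ℕ.suc m) * ℕ.suc 0) ≡ ℕ.suc m * ℕ.suc m
denominator-1·q·q = solve-∀

denominator-q : ∀ m → ℕ.suc (m + 0 * ℕ.suc m) ≡ ℕ.suc m
denominator-q = solve-∀

-- The hypotheses of the theorem, for k = p / q with q = 1 + d, as
-- inequalities between natural numbers.
module Ratio (p d : ℕ) .(coprime : Coprime p (suc d)) where

  k : ℚ
  k = mkℚ (ℤ.+ p) d coprime

  q : ℕ
  q = suc d

  private
    k-fraction : Fraction k p d
    k-fraction = fraction ℚᵘ.≃-refl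

  1<k⇒q<p : ⟦ 1 ⟧ ℚ.< k → q < p
  1<k⇒q<p h = subst₂ _<_ (+-identityʳ q) (*-identityʳ p) (fraction-< (fraction-⟦⟧ 1) k-fraction h)

  ≤c·k·b : ∀ a c b → ⟦ a ⟧ ℚ.≤ ⟦ c ⟧ ℚ.* k ℚ.* ⟦ b ⟧ → a * q ≤ c * p * b
  ≤c·k·b a c b h = subst₂ _≤_ (cong (a *_) (denominator-1·q d)) (*-identityʳ _)
    (fraction-≤ (fraction-⟦⟧ a) (fraction-* (fraction-* (fraction-⟦⟧ c) k-fraction) (fraction-⟦⟧ b)) h)

  ≰32·k·k·b : ∀ a b → ¬ (⟦ a ⟧ ℚ.≤ ⟦ 32 ⟧ ℚ.* k ℚ.* k ℚ.* ⟦ b ⟧) → 32 * p * p * b < a * (q * q)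
  ≰32·k·k·b a b h = subst₂ _<_ (*-identityʳ _) (cong (a *_) (denominator-1·q·q d))
    (fraction-< (fraction-* (fraction-* (fraction-* (fraction-⟦⟧ 32) k-fraction) k-fraction) (fraction-⟦⟧ b))
                (fraction-⟦⟧ a) (ℚ.≰⇒> h))

  16·k≤ : ∀ v → ⟦ 16 ⟧ ℚ.* k ℚ.≤ ⟦ v ⟧ → 16 * p ≤ v * q
  16·k≤ v h = subst₂ _≤_ (*-identityʳ _) (cong (v *_) (denominator-q d))
    (fraction-≤ (fraction-* (fraction-⟦⟧ 16) k-fraction) (fraction-⟦⟧ v) h)

  <32·k·e : ∀ v e → v * v * q < 32 * p * e → ⟦ v ⟧ ℚ.* ⟦ v ⟧ ℚ.< ⟦ 32 ⟧ ℚ.* k ℚ.* ⟦ e ⟧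
  <32·k·e v e h = fraction-<⁻ (fraction-* (fraction-⟦⟧ v) (fraction-⟦⟧ v))
                              (fraction-* (fraction-* (fraction-⟦⟧ 32) k-fraction) (fraction-⟦⟧ e))
    (subst₂ _<_ (cong (v * v *_) (sym (denominator-1·q d))) (sym (*-identityʳ _)) h)

deletion-min-degree : ∀ {n} {G : Graph n} {k S T} → Reaches G k S T → MinDegOK G k T
deletion-min-degree (done ok)            = ok
deletion-min-degree (step _ _ _ _ rest) = deletion-min-degree rest

-- Writing k = p / q, the minimum degree of the final graph,
-- the codegree threshold of Γ and the size of U become the hypotheses of
-- `CloseCodegrees`; its conclusion v²q < 32pe is v² < 32ke.
lemma2 : (n : ℕ) (k : ℚ) → ⟦ 1 ⟧ ℚ.< k → ⟦ 1048576 ⟧ ℚ.* k ℚ.* k ℚ.* k ℚ.* k ℚ.* k ℚ.< ⟦ n ⟧ →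
         (G : Graph n) → ⟦ n ⟧ ℚ.* ⟦ n ⟧ ℚ.≤ ⟦ edgeCount (adj G) ⟧ ℚ.* k →
         (S : Subset n) → Reaches G k ⊤ S →
         (H : BipSub G S) → IsMaxBip H → card (B H) ≤ card (A H) →
         (U : Subset n) → U ⊆ A H → ⟦ 16 ⟧ ℚ.* k ℚ.≤ ⟦ card U ⟧ →
         ⟦ card U ⟧ ℚ.* ⟦ card U ⟧ ℚ.< ⟦ 32 ⟧ ℚ.* k ℚ.* ⟦ edgesΓIn k H U ⟧
lemma2 n (mkℚ (ℤ.+ p) d coprime) 1<k _ G _ S reaches H maximal B≤A U U⊆A 16k≤v =
  <32·k·e (card U) (edgesΓIn k H U)
    (CloseCodegrees.many-close-pairs H maximal B≤A p q (1<k⇒q<p 1<k) (s≤s z≤n) min-degree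
                                     (Γadj k H) (Γ-sym k H) far⇒small U U⊆A (16·k≤ (card U) 16k≤v))
  where
  open Ratio p d coprime
  min-degree : ∀ x → x ∈ S → n * q ≤ 2 * p * degIn G S x
  min-degree x x∈S = ≤c·k·b n 2 (degIn G S x) (deletion-min-degree reaches x x∈S)
  far⇒small : ∀ x y → Γadj k H x y ≡ false → 32 * p * p * codeg H x y < n * (q * q)
  far⇒small x y x≁y = ≰32·k·k·b n (codeg H x y) (λ x~y → subst T x≁y (ℚ.≤⇒≤ᵇ x~y))
lemma2 n (mkℚ ℤ.-[1+ _ ] _ _) (ℚ.*<* ()) _ _ _ _ _ _ _ _ _ _ _
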